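{- For every $2\le m,n\le\infty$, the class $\mathcal A_{T_{m,n}}$ does not have EPPA.
   Context: For $2\le m,n\le\infty$, $T_{m,n}$ is the countable connected regular tree-like graph in which every block (maximal 2-connected subgraph) is a clique of order $n$ and every vertex is a cut vertex lying in exactly $m$ blocks. $\mathcal A_{T_{m,n}}$ is the age (class of finite substructures) of the metric space on the vertices of $T_{m,n}$ with the graph (shortest-path) distance. A class $\mathcal K$ has EPPA if for every $\mathbf A\in\mathcal K$ there is $\mathbf B\in\mathcal K$ containing $\mathbf A$ as a substructure such that every isomorphism between substructures of $\mathbf A$ extends to an automorphism of $\mathbf B$. -}

module Defs where

open import Data.Nat using (ℕ; zero; suc; _+_; _∸_; _≤_)
import Data.Nat as N
open import Data.Fin using (Fin)
import Data.Fin.Properties as FinP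
open import Data.Unit using (⊤)
open import Data.Maybe using (Maybe; just; nothing)
open import Data.List using (List; []; _∷_; length)
open import Data.Product using (Σ; _×_; _,_)
open import Relation.Nullary using (¬_; yes; no)
open import Relation.Binary.Definitions using (DecidableEquality)
open import Relation.Binary.PropositionalEquality using (_≡_)
open import Function.Definitions using (Injective)

-- Cardinals 2 ≤ m ≤ ∞ (∞ = countably infinite, ℵ₀)

data Card : Set where
  fin : ℕ → Card
  ∞   : Card

El : Card → Set
El (fin k) = Fin k
El ∞       = ℕ

pred : Card → Card
pred (fin k) = fin (k ∸ 1)
pred ∞       = ∞

AtLeast2 : Card → Set
AtLeast2 (fin k) = 2 ≤ k
AtLeast2 ∞       = ⊤

El-≟ : (c : Card) → DecidableEquality (El c)
El-≟ (fin k) = FinP._≟_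
El-≟ ∞       = N._≟_

-- The graph T_{m,n}, via its block–cutvertex (incidence) tree rooted at
-- a vertex r.  r lies in m blocks (indexed by El m); every block has
-- n - 1 members besides its parent vertex (indexed by El (pred n));
-- every non-root vertex lies in its parent block and m - 1 further
-- blocks (indexed by El (pred m)).  A vertex is the path to it from r.

Vtx : Card → Card → Set
Vtx m n = Maybe (El m × El (pred n) × List (El (pred m) × El (pred n)))

depthL : ∀ {A B : Set} → List (A × B) → ℕ
depthL xs = length xs

depth : ∀ {m n} → Vtx m n → ℕ
depth nothing            = 0
depth (just (_ , _ , xs)) = suc (length xs)

-- Graph distance in T_{m,n} between two vertices below a common vertex,
-- given as paths of (block, member) steps from that common vertex.
distL : ∀ {A B : Set} → DecidableEquality A → DecidableEquality B →
        List (A × B) → List (A × B) → ℕ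
distL _ _ [] ys = length ys
distL _ _ (x ∷ xs) [] = suc (length xs)
distL eqA eqB ((i , j) ∷ xs) ((i' , j') ∷ ys) with eqA i i'
... | no _  = suc (length xs) + suc (length ys)        -- different blocks
... | yes _ with eqB j j'
...   | no _  = suc (length xs + length ys)            -- same block, different members
...   | yes _ = distL eqA eqB xs ys

dist : ∀ {m n} → Vtx m n → Vtx m n → ℕ
dist nothing v = depth v
dist u nothing = depth u
dist {m} {n} (just (i , j , xs)) (just (i' , j' , ys)) with El-≟ m i i'
... | no _  = suc (length xs) + suc (length ys)
... | yes _ with El-≟ (pred n) j j'
...   | no _  = suc (length xs + length ys)
...   | yes _ = distL (El-≟ (pred m)) (El-≟ (pred n)) xs ys

record FinStr : Set where
  field
    size : ℕ
    d    : Fin size → Fin size → ℕ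
open FinStr public

Class : Set₁
Class = FinStr → Set

-- Age of T_{m,n}: finite structures isomorphic to a finite substructure of
-- (V(T_{m,n}), dist), i.e. admitting an isometric embedding into it.
Age : Card → Card → Class
Age m n A = Σ (Fin (size A) → Vtx m n) λ f →
              Injective _≡_ _≡_ f × (∀ x y → d A x y ≡ dist (f x) (f y))

record Embedding (A B : FinStr) : Set where
  field
    emb     : Fin (size A) → Fin (size B)
    emb-inj : Injective _≡_ _≡_ emb
    emb-iso : ∀ x y → d B (emb x) (emb y) ≡ d A x y

record PartialIso (A : FinStr) : Set where
  field
    pmap     : Fin (size A) → Maybe (Fin (size A))
    pmap-inj : ∀ {x y z} → pmap x ≡ just z → pmap y ≡ just z → x ≡ y
    pmap-iso : ∀ {x y x' y'} → pmap x ≡ just x' → pmap y ≡ just y' →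
               d A x' y' ≡ d A x y

record Automorphism (B : FinStr) : Set where
  field
    fwd     : Fin (size B) → Fin (size B)
    bwd     : Fin (size B) → Fin (size B)
    fwd-bwd : ∀ x → fwd (bwd x) ≡ x
    bwd-fwd : ∀ x → bwd (fwd x) ≡ x
    fwd-iso : ∀ x y → d B (fwd x) (fwd y) ≡ d B x y

EPPA : Class → Set
EPPA K = ∀ A → K A →
  Σ FinStr λ B → K B × Σ (Embedding A B) λ e →
    ∀ (p : PartialIso A) → Σ (Automorphism B) λ g →
      ∀ x x' → PartialIso.pmap p x ≡ just x' →
        Automorphism.fwd g (Embedding.emb e x) ≡ Embedding.emb e x'

{-# OPTIONS --safe #-}
module Submission where

-- Take the geodesic path 0 — 1 — 2 and its partial isometry 0 ↦ 1, 1 ↦ 2.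
-- If an automorphism g of a finite B ⊆ T_{m,n} extends it, the g-orbit
-- x₀, x₁, … of the image of 0 is periodic (B is finite), consecutive points
-- are adjacent and x_k, x_{k+2} are at distance 2.  Choose k so that x_{k+1}
-- has maximal depth (distance to the root).  Then x_k and x_{k+2} are
-- neighbours of x_{k+1} that are not deeper than it, hence both lie in the
-- block joining x_{k+1} to its parent; a block is a clique, so they are at
-- distance at most 1.

open import Defs
open import Data.Nat using (ℕ; zero; suc; _+_; _∸_; _*_; _≤_; z≤n; s≤s; ∣_-_∣; _%_; _/_)
open import Data.Nat.Properties
  using (≤-refl; ≤-reflexive; +-suc; +-identityʳ; +-comm; +-assoc; m+[n∸m]≡n; m+1+n≢0;
         suc-injective; n<1+n; 1+n≰n; module ≤-Reasoning)
open import Data.Nat.DivMod using (m≡m%n+[m/n]*n; m%n<n)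
open import Data.Nat.GeneralisedArithmetic using (fold; fold-+)
open import Data.Fin using (Fin; toℕ; zero; suc)
open import Data.Fin.Properties using (toℕ-injective; pigeonhole)
open import Data.List using (List; []; _∷_; length; map; replicate; upTo)
open import Data.List.Properties using (length-map; length-replicate)
open import Data.List.Extrema.Nat using (argmax; f[xs]≤f[argmax])
open import Data.List.Membership.Propositional.Properties using (∈-upTo⁺)
import Data.List.Relation.Unary.All as All
open import Data.Maybe using (Maybe; just; nothing)
open import Data.Product using (∃-syntax; _×_; _,_; map₁)
open import Data.Sum using (_⊎_; inj₁; inj₂)
import Data.Sum.Properties as Sum
open import Data.Empty using (⊥; ⊥-elim)
open import Function using (_∘_)
open import Function.Definitions using (Injective)
open import Relation.Nullary using (¬_; yes; no)
open import Relation.Binary.Definitions using (DecidableEquality)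
open import Relation.Binary.PropositionalEquality

-- u lies in the block through v and the parent of v (u = v allowed).
data InUpperBlock {A B : Set} : List (A × B) → List (A × B) → Set where
  parent  : ∀ {a b} → InUpperBlock [] ((a , b) ∷ [])
  sibling : ∀ {a b b'} → InUpperBlock ((a , b) ∷ []) ((a , b') ∷ [])
  descend : ∀ {a b u v} → InUpperBlock u v → InUpperBlock ((a , b) ∷ u) ((a , b) ∷ v)

module _ {A B : Set} (_≟A_ : DecidableEquality A) (_≟B_ : DecidableEquality B) where

  private
    D : List (A × B) → List (A × B) → ℕ
    D = distL _≟A_ _≟B_

  distL-diffMember : ∀ {a b b' xs ys} → b ≢ b' →
                     D ((a , b) ∷ xs) ((a , b') ∷ ys) ≡ suc (length xs + length ys)
  distL-diffMember {a} b≢b'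
    rewrite ≡-≟-identity _≟A_ {a} refl | ≢-≟-identity _≟B_ b≢b' = refl

  distL-sameStep : ∀ {a b xs ys} → D ((a , b) ∷ xs) ((a , b) ∷ ys) ≡ D xs ys
  distL-sameStep {a} {b}
    rewrite ≡-≟-identity _≟A_ {a} refl | ≡-≟-identity _≟B_ {b} refl = refl

  distL≡1⇒InUpperBlock : ∀ u v → D u v ≡ 1 → length u ≤ length v → InUpperBlock u v
  distL≡1⇒InUpperBlock [] (_ ∷ []) _ _ = parent
  distL≡1⇒InUpperBlock ((a , b) ∷ u) ((a' , b') ∷ v) uv≡1 (s≤s |u|≤|v|) with a ≟A a'
  ... | no _ = ⊥-elim (m+1+n≢0 _ (suc-injective uv≡1))
  ... | yes refl with b ≟B b'
  ...   | yes refl = descend (distL≡1⇒InUpperBlock u v uv≡1 |u|≤|v|)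
  ...   | no _     = siblings u v uv≡1
    where
    siblings : ∀ u v → suc (length u + length v) ≡ 1 →
               InUpperBlock ((a , b) ∷ u) ((a , b') ∷ v)
    siblings []      []      _  = sibling
    siblings []      (_ ∷ _) ()
    siblings (_ ∷ _) _       ()

  InUpperBlock⇒distL≤1 : ∀ {u v w} → InUpperBlock u v → InUpperBlock w v → D u w ≤ 1
  InUpperBlock⇒distL≤1 parent  parent  = z≤n
  InUpperBlock⇒distL≤1 parent  sibling = ≤-refl
  InUpperBlock⇒distL≤1 sibling parent  = ≤-refl
  InUpperBlock⇒distL≤1 (sibling {b = b}) (sibling {b = c}) with b ≟B c
  ... | yes refl = subst (_≤ 1) (sym distL-sameStep) z≤n
  ... | no b≢c   = ≤-reflexive (distL-diffMember b≢c)
  InUpperBlock⇒distL≤1 (descend p) (descend q) =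
    subst (_≤ 1) (sym distL-sameStep) (InUpperBlock⇒distL≤1 p q)

  distL-map₁ : ∀ {A'} (_≟A'_ : DecidableEquality A') {f : A → A'} → Injective _≡_ _≡_ f →
               ∀ xs ys → D xs ys ≡ distL _≟A'_ _≟B_ (map (map₁ f) xs) (map (map₁ f) ys)
  distL-map₁ _ {f} _ [] ys       = sym (length-map (map₁ f) ys)
  distL-map₁ _ {f} _ (_ ∷ xs) [] = cong suc (sym (length-map (map₁ f) xs))
  distL-map₁ _≟A'_ {f} f-inj ((a , b) ∷ xs) ((a' , b') ∷ ys) with a ≟A a' | f a ≟A' f a'
  ... | no a≢a'  | yes fa≡fa' = ⊥-elim (a≢a' (f-inj fa≡fa'))
  ... | yes refl | no fa≢fa   = ⊥-elim (fa≢fa refl)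
  ... | no _     | no _ rewrite length-map (map₁ f) xs | length-map (map₁ f) ys = refl
  ... | yes refl | yes _ with b ≟B b'
  ...   | no _ rewrite length-map (map₁ f) xs | length-map (map₁ f) ys = refl
  ...   | yes refl = distL-map₁ _≟A'_ f-inj xs ys

module _ {m n : Card} where

  private
    _≟m_  = El-≟ m
    _≟m′_ = El-≟ (pred m)
    _≟n′_ = El-≟ (pred n)

  dist-sameStep : ∀ {i j xs ys} →
                  dist {m} {n} (just (i , j , xs)) (just (i , j , ys)) ≡ distL _≟m′_ _≟n′_ xs ys
  dist-sameStep {i} {j}
    rewrite ≡-≟-identity _≟m_ {i} refl | ≡-≟-identity _≟n′_ {j} refl = refl

  BlockIndex : Set
  BlockIndex = El m ⊎ El (pred m)

  -- A vertex as the path from the root over a single alphabet of block indices,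
  -- which makes dist an instance of distL.
  path : Vtx m n → List (BlockIndex × El (pred n))
  path nothing             = []
  path (just (i , j , xs)) = (inj₁ i , j) ∷ map (map₁ inj₂) xs

  private
    _≟B_ : DecidableEquality BlockIndex
    _≟B_ = Sum.≡-dec _≟m_ _≟m′_

  depth≡length-path : ∀ v → depth v ≡ length (path v)
  depth≡length-path nothing             = refl
  depth≡length-path (just (_ , _ , xs)) = cong suc (sym (length-map (map₁ inj₂) xs))

  -- inj₁ i ≟B inj₁ i' computes from i ≟m i', so this with also decides the
  -- first step of the paths.
  dist≡distL-path : ∀ u v → dist u v ≡ distL _≟B_ _≟n′_ (path u) (path v)
  dist≡distL-path nothing v          = depth≡length-path v
  dist≡distL-path u@(just _) nothing = depth≡length-path u
  dist≡distL-path (just (i , j , xs)) (just (i' , j' , ys)) with i ≟m i'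
  ... | no _ rewrite length-map (map₁ {B = BlockIndex} inj₂) xs
                   | length-map (map₁ {B = BlockIndex} inj₂) ys = refl
  ... | yes refl with j ≟n′ j'
  ...   | no _ rewrite length-map (map₁ {B = BlockIndex} inj₂) xs
                     | length-map (map₁ {B = BlockIndex} inj₂) ys = refl
  ...   | yes refl = distL-map₁ _≟m′_ _≟n′_ _≟B_ Sum.inj₂-injective xs ys

  dist-upper-neighbours : ∀ u v w → dist u v ≡ 1 → dist w v ≡ 1 →
                          depth u ≤ depth v → depth w ≤ depth v → dist u w ≤ 1
  dist-upper-neighbours u v w uv≡1 wv≡1 u≤v w≤v
    rewrite dist≡distL-path u v | dist≡distL-path w v | dist≡distL-path u w
          | depth≡length-path u | depth≡length-path v | depth≡length-path w =
    InUpperBlock⇒distL≤1 _≟B_ _≟n′_ (upper u uv≡1 u≤v) (upper w wv≡1 w≤v)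
    where
    upper = λ x → distL≡1⇒InUpperBlock _≟B_ _≟n′_ (path x) (path v)

module _ {m n : Card} (i : El m) (j : El (pred n)) (k : El (pred m)) where

  ray : ℕ → Vtx m n
  ray zero    = nothing
  ray (suc l) = just (i , j , replicate l (k , j))

  depth-ray : ∀ l → depth (ray l) ≡ l
  depth-ray zero    = refl
  depth-ray (suc l) = cong suc (length-replicate l)

  ray-injective : ∀ {l l'} → ray l ≡ ray l' → l ≡ l'
  ray-injective {l} {l'} eq = trans (sym (depth-ray l)) (trans (cong depth eq) (depth-ray l'))

  dist-ray : ∀ l l' → dist (ray l) (ray l') ≡ ∣ l - l' ∣
  dist-ray zero    l'       = depth-ray l'
  dist-ray (suc l) zero     = depth-ray (suc l)
  dist-ray (suc l) (suc l') =
    trans (dist-sameStep {m} {n} {i} {j} {replicate l _} {replicate l' _}) (distL-replicate l l')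
    where
    distL-replicate : ∀ l l' → distL (El-≟ (pred m)) (El-≟ (pred n))
                                 (replicate l (k , j)) (replicate l' (k , j)) ≡ ∣ l - l' ∣
    distL-replicate zero    l'       = length-replicate l'
    distL-replicate (suc l) zero     = cong suc (length-replicate l)
    distL-replicate (suc l) (suc l') =
      trans (distL-sameStep (El-≟ (pred m)) (El-≟ (pred n)) {k} {j}) (distL-replicate l l')

Path : ℕ → FinStr
Path k = record { size = k ; d = λ x y → ∣ toℕ x - toℕ y ∣ }

inhabitant : (c : Card) → AtLeast2 c → El c
inhabitant (fin (suc (suc _))) _ = zero
inhabitant (fin 1)             (s≤s ())
inhabitant ∞                   _ = 0

inhabitant-pred : (c : Card) → AtLeast2 c → El (pred c)
inhabitant-pred (fin (suc (suc _))) _ = zero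
inhabitant-pred (fin 1)             (s≤s ())
inhabitant-pred ∞                   _ = 0

Path∈Age : ∀ {m n} → AtLeast2 m → AtLeast2 n → ∀ k → Age m n (Path k)
Path∈Age {m} {n} 2≤m 2≤n _ =
  ray i j k ∘ toℕ , toℕ-injective ∘ ray-injective i j k , λ x y → sym (dist-ray i j k (toℕ x) (toℕ y))
  where
  i = inhabitant m 2≤m
  j = inhabitant-pred n 2≤n
  k = inhabitant-pred m 2≤m

shift : Fin 3 → Maybe (Fin 3)
shift zero          = just (suc zero)
shift (suc zero)    = just (suc (suc zero))
shift (suc (suc _)) = nothing

shift-toℕ : ∀ {x y} → shift x ≡ just y → toℕ y ≡ suc (toℕ x)
shift-toℕ {zero}     refl = refl
shift-toℕ {suc zero} refl = refl

shiftIso : PartialIso (Path 3)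
shiftIso = record
  { pmap     = shift
  ; pmap-inj = λ x↦z y↦z →
      toℕ-injective (suc-injective (trans (sym (shift-toℕ x↦z)) (shift-toℕ y↦z)))
  ; pmap-iso = λ x↦x' y↦y' → cong₂ ∣_-_∣ (shift-toℕ x↦x') (shift-toℕ y↦y')
  }

module _ {s} (f : Fin s → Fin s) (f-inj : Injective _≡_ _≡_ f) where

  fold-injective : ∀ k {x y} → fold x f k ≡ fold y f k → x ≡ y
  fold-injective zero    eq = eq
  fold-injective (suc k) eq = fold-injective k (f-inj eq)

  orbit-returns : ∀ x → ∃[ p ] fold x f (suc p) ≡ x
  orbit-returns x with i , j , i<j , fi≡fj ← pigeonhole (n<1+n s) (fold x f ∘ toℕ) =
    p , fold-injective (toℕ i) (begin
      fold (fold x f (suc p)) f (toℕ i) ≡⟨ fold-+ x f (toℕ i) ⟨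
      fold x f (toℕ i + suc p)          ≡⟨ cong (fold x f) i+1+p≡j ⟩
      fold x f (toℕ j)                  ≡⟨ fi≡fj ⟨
      fold x f (toℕ i)                  ∎)
    where
    open ≡-Reasoning
    p = toℕ j ∸ suc (toℕ i)
    i+1+p≡j : toℕ i + suc p ≡ toℕ j
    i+1+p≡j = trans (+-suc (toℕ i) p) (m+[n∸m]≡n i<j)

module _ (h : ℕ → ℕ) (p : ℕ) (periodic : ∀ k → h (k + suc p) ≡ h k) where

  private
    P = suc p

  periodic-multiple : ∀ r q → h (r + q * P) ≡ h r
  periodic-multiple r zero    = cong h (+-identityʳ r)
  periodic-multiple r (suc q) = begin
    h (r + (P + q * P)) ≡⟨ cong (h ∘ (r +_)) (+-comm P (q * P)) ⟩
    h (r + (q * P + P)) ≡⟨ cong h (+-assoc r (q * P) P) ⟨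
    h (r + q * P + P)   ≡⟨ periodic (r + q * P) ⟩
    h (r + q * P)       ≡⟨ periodic-multiple r q ⟩
    h r                 ∎
    where open ≡-Reasoning

  periodic-% : ∀ k → h k ≡ h (k % P)
  periodic-% k = trans (cong h (m≡m%n+[m/n]*n k P)) (periodic-multiple (k % P) (k / P))

  periodic⇒maximum-at-suc : ∃[ j ] ∀ k → h k ≤ h (suc j)
  periodic⇒maximum-at-suc = j* + p , λ k → begin
    h k              ≡⟨ periodic-% k ⟩
    h (k % P)        ≤⟨ All.lookup (f[xs]≤f[argmax] {f = h} 0 (upTo P)) (∈-upTo⁺ (m%n<n k P)) ⟩
    h j*             ≡⟨ periodic j* ⟨
    h (j* + P)       ≡⟨ cong h (+-suc j* p) ⟩
    h (suc (j* + p)) ∎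
    where
    open ≤-Reasoning
    j* = argmax h 0 (upTo P)

module _ {m n} (B : FinStr) (F : Fin (size B) → Vtx m n)
         (F-iso : ∀ x y → d B x y ≡ dist (F x) (F y)) (g : Automorphism B) where

  open Automorphism g

  fwd-injective : Injective _≡_ _≡_ fwd
  fwd-injective {x} {y} eq = trans (sym (bwd-fwd x)) (trans (cong bwd eq) (bwd-fwd y))

  fold-fwd-dist : ∀ x a b k →
                  d B (fold x fwd (a + k)) (fold x fwd (b + k)) ≡ d B (fold x fwd a) (fold x fwd b)
  fold-fwd-dist x a b zero    rewrite +-identityʳ a | +-identityʳ b = refl
  fold-fwd-dist x a b (suc k) rewrite +-suc a k | +-suc b k =
    trans (fwd-iso _ _) (fold-fwd-dist x a b k)

  no-shifted-geodesic : ∀ {x y z} → fwd x ≡ y → fwd y ≡ z →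
                        d B x y ≡ 1 → d B z y ≡ 1 → d B x z ≡ 2 → ⊥
  no-shifted-geodesic {x} refl refl xy≡1 zy≡1 xz≡2 =
    let p , returns = orbit-returns fwd fwd-injective x
        j , maximal = periodic⇒maximum-at-suc (depth ∘ F ∘ orbit) p (orbit-periodic returns)
    in 1+n≰n (subst (_≤ 1) (dist-at j 0 2 xz≡2)
         (dist-upper-neighbours (F (orbit j)) (F (orbit (1 + j))) (F (orbit (2 + j)))
           (dist-at j 0 1 xy≡1) (dist-at j 2 1 zy≡1) (maximal j) (maximal (2 + j))))
    where
    orbit : ℕ → Fin (size B)
    orbit = fold x fwd
    orbit-periodic : ∀ {p} → orbit (suc p) ≡ x →
                     ∀ k → depth (F (orbit (k + suc p))) ≡ depth (F (orbit k))
    orbit-periodic returns k =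
      cong (depth ∘ F) (trans (fold-+ x fwd k) (cong (λ y → fold y fwd k) returns))
    dist-at : ∀ j a b {l} → d B (orbit a) (orbit b) ≡ l →
              dist (F (orbit (a + j))) (F (orbit (b + j))) ≡ l
    dist-at j a b eq = trans (sym (F-iso _ _)) (trans (fold-fwd-dist x a b j) eq)

theorem8p5 : (m n : Card) → AtLeast2 m → AtLeast2 n → ¬ EPPA (Age m n)
theorem8p5 m n 2≤m 2≤n eppa
  with B , (F , _ , F-iso) , e , extend ← eppa (Path 3) (Path∈Age 2≤m 2≤n 3)
  with g , g-extends ← extend shiftIso =
  no-shifted-geodesic B F F-iso g
    (g-extends zero (suc zero) refl) (g-extends (suc zero) (suc (suc zero)) refl)
    (emb-iso zero (suc zero)) (emb-iso (suc (suc zero)) (suc zero))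
    (emb-iso zero (suc (suc zero)))
  where open Embedding e
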